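{- Let $L$ and $R$ be nonempty subsets of a group $G$. (1) In $2\mathrm{S}(G;L,R)$ there exist two words in $L$ of different lengths that are weakly connected to each other if and only if there is a word in $L$ that is weakly connected to $e$. (2) In $2\mathrm{S}(G;L,R)$ there exists a word $w_{L,n}$ in $L$ of length $n$ weakly connected to $e$ if and only if there exists a word $w_{L^{ -1},n}$ in $L^{ -1}$ of length $n$ weakly connected to $e$.
   Context: For a group $G$ with identity $e$ and nonempty subsets $L,R\subseteq G$, the two-sided group digraph $2\mathrm{S}(G;L,R)$ has vertex set $G$ and a directed arc $(g,h)$ if and only if $h=l^{ -1}gr$ for some $l\in L$, $r\in R$. Vertex $g$ is weakly connected to $h$ if there is a sequence $g=g_0,\dots,g_k=h$ such that for each $i$ either $(g_{i-1},g_i)$ or $(g_i,g_{i-1})$ is an arc. A word in a nonempty set $S$ of length $n>0$ is a product $s_1\cdots s_n$ with all $s_i\in S$, regarded as the element of $G$ it represents; $L^{ -1}=\{l^{ -1}:l\in L\}$. -}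

module Defs where

open import Level using (Level; _⊔_)
open import Algebra.Bundles using (Group)
open import Data.Nat using (ℕ; suc)
open import Data.Vec using (Vec; []; _∷_; foldr₁)
open import Data.Vec.Relation.Unary.All using (All)
open import Data.Product using (Σ; ∃; ∃-syntax; _×_; _,_)
open import Data.Sum using (_⊎_)
open import Relation.Unary using (Pred)
open import Relation.Binary.PropositionalEquality using (_≡_)

module TwoSided {c ℓ : Level} (G : Group c ℓ) where
  open Group G

  Nonempty : {p : Level} → Pred Carrier p → Set (c ⊔ p)
  Nonempty S = ∃[ x ] S x

  Inv : {p : Level} → Pred Carrier p → Pred Carrier (c ⊔ ℓ ⊔ p)
  Inv S x = ∃[ l ] (S l × x ≈ l ⁻¹)

  Arc : {p q : Level} → Pred Carrier p → Pred Carrier q →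
        Carrier → Carrier → Set (c ⊔ ℓ ⊔ p ⊔ q)
  Arc L R g h = ∃[ l ] ∃[ r ] (L l × R r × h ≈ (l ⁻¹ ∙ g) ∙ r)

  data WeaklyConnected {p q : Level} (L : Pred Carrier p) (R : Pred Carrier q) :
       Carrier → Carrier → Set (c ⊔ ℓ ⊔ p ⊔ q) where
    done : ∀ {g h} → g ≈ h → WeaklyConnected L R g h
    step : ∀ {g g₁ h} → (Arc L R g g₁ ⊎ Arc L R g₁ g) →
           WeaklyConnected L R g₁ h → WeaklyConnected L R g h

  prod : {n : ℕ} → Vec Carrier (suc n) → Carrier
  prod = foldr₁ _∙_

  IsWord : {p : Level} → Pred Carrier p → ℕ → Carrier → Set (c ⊔ ℓ ⊔ p)
  IsWord S n x = Σ ℕ λ k → n ≡ suc k × Σ (Vec Carrier (suc k)) λ ws →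
                   All S ws × x ≈ prod ws

module Submission where

-- Fix l₀ ∈ L and r₀ ∈ R and write g ~ h for weak connectivity.  An arc is
-- exactly a move  l ∙ y → y ∙ r  (l ∈ L, r ∈ R).  From this single fact we show
-- that ~ is invariant under right translation by r₀ and by r₀⁻¹, hence by
-- every power of r₀ and of r₀⁻¹ (the heart of the proof).  Moving the letters
-- of a word one at a time to the right end shows that every word of length n
-- in L is weakly connected to r₀ ^ n, and every word of length n in L⁻¹ to
-- (r₀⁻¹) ^ n.  Hence "some word of length n in L (resp. L⁻¹) is weakly
-- connected to e" just says that n > 0 and r₀ ^ n ~ e (resp. (r₀⁻¹) ^ n ~ e).
-- Translation by powers of r₀ then gives both parts:
--   (1) r₀ ^ m ~ r₀ ^ n with m < n iff r₀ ^ (n ∸ m) ~ e, and r₀ ^ d ~ e yields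
--       r₀ ^ (d + d) ~ r₀ ^ d;
--   (2) r₀ ^ n ~ e iff (r₀⁻¹) ^ n ~ e.

open import Defs
open import Level using (Level; _⊔_)
open import Algebra.Bundles using (Group)
open import Data.Nat using (ℕ; zero; suc; _+_; _∸_; _<_; z<s)
open import Data.Nat.Properties
  using (+-comm; <-cmp; <⇒≤; <⇒≢; m<m+n; m<n⇒0<n; m<n⇒0<n∸m; m∸n+n≡m)
open import Data.Vec using (Vec; _∷_; []; tabulate)
open import Data.Vec.Relation.Unary.All using (All; _∷_)
open import Data.Vec.Relation.Unary.All.Properties using (tabulate⁺)
open import Data.Product using (∃-syntax; _×_; _,_)
open import Data.Sum using (inj₁; inj₂; swap)
open import Function.Bundles using (Equivalence; _⇔_; mk⇔)
open import Relation.Binary.Bundles using (Preorder)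
open import Relation.Binary.Definitions using (tri<; tri≈; tri>)
open import Relation.Binary.PropositionalEquality as ≡ using (_≢_)
open import Relation.Nullary using (contradiction)
open import Relation.Unary using (Pred)

module Powers {c ℓ : Level} (G : Group c ℓ) where
  open Group G
  open import Algebra.Properties.Group G using (⁻¹-anti-homo-∙; ε⁻¹≈ε)
  open import Algebra.Properties.Monoid.Mult monoid public
    using (×-homo-+; ×-homo-1) renaming (_×_ to _times_)
  open import Relation.Binary.Reasoning.Setoid setoid

  infixr 8 _^_
  _^_ : Carrier → ℕ → Carrier
  x ^ n = n times x

  ^-comm : ∀ x n → x ^ n ∙ x ≈ x ∙ x ^ n
  ^-comm x n = begin
    x ^ n ∙ x      ≈⟨ ∙-congˡ (×-homo-1 x) ⟨
    x ^ n ∙ x ^ 1  ≈⟨ ×-homo-+ x n 1 ⟨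
    x ^ (n + 1)    ≡⟨ ≡.cong (x ^_) (+-comm n 1) ⟩
    x ^ (1 + n)    ∎

  ^-⁻¹ : ∀ x n → (x ⁻¹) ^ n ≈ (x ^ n) ⁻¹
  ^-⁻¹ x zero    = sym ε⁻¹≈ε
  ^-⁻¹ x (suc n) = begin
    x ⁻¹ ∙ (x ⁻¹) ^ n  ≈⟨ ∙-congˡ (^-⁻¹ x n) ⟩
    x ⁻¹ ∙ (x ^ n) ⁻¹  ≈⟨ ⁻¹-anti-homo-∙ (x ^ n) x ⟨
    (x ^ n ∙ x) ⁻¹     ≈⟨ ⁻¹-cong (^-comm x n) ⟩
    (x ∙ x ^ n) ⁻¹     ∎

  ^-inverseʳ : ∀ x n → x ^ n ∙ (x ⁻¹) ^ n ≈ ε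
  ^-inverseʳ x n = trans (∙-congˡ (^-⁻¹ x n)) (inverseʳ (x ^ n))

  ^-inverseˡ : ∀ x n → (x ⁻¹) ^ n ∙ x ^ n ≈ ε
  ^-inverseˡ x n = trans (∙-congʳ (^-⁻¹ x n)) (inverseˡ (x ^ n))

module WeakComponents {c ℓ p q : Level} (G : Group c ℓ)
  (L : Pred (Group.Carrier G) p) (R : Pred (Group.Carrier G) q) where
  open Group G
  open TwoSided G
  open Powers G
  open import Algebra.Properties.Group G
    using (\\-leftDividesˡ; \\-leftDividesʳ; //-rightDividesˡ)

  infix 4 _~_
  _~_ : Carrier → Carrier → Set (c ⊔ ℓ ⊔ p ⊔ q)
  _~_ = WeaklyConnected L R

  ~-respʳ : ∀ {g h h′} → g ~ h → h ≈ h′ → g ~ h′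
  ~-respʳ (done g≈h) h≈h′ = done (trans g≈h h≈h′)
  ~-respʳ (step a w)  h≈h′ = step a (~-respʳ w h≈h′)

  ~-respˡ : ∀ {g g′ h} → g ≈ g′ → g ~ h → g′ ~ h
  ~-respˡ g≈g′ (done g≈h) = done (trans (sym g≈g′) g≈h)
  ~-respˡ g≈g′ (step (inj₁ (l , r , Ll , Rr , eq)) w) =
    step (inj₁ (l , r , Ll , Rr , trans eq (∙-congʳ (∙-congˡ g≈g′)))) w
  ~-respˡ g≈g′ (step (inj₂ (l , r , Ll , Rr , eq)) w) =
    step (inj₂ (l , r , Ll , Rr , trans (sym g≈g′) eq)) w

  ~-trans : ∀ {g h k} → g ~ h → h ~ k → g ~ k
  ~-trans (done g≈h) w′ = ~-respˡ (sym g≈h) w′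
  ~-trans (step a w) w′ = step a (~-trans w w′)

  ~-sym : ∀ {g h} → g ~ h → h ~ g
  ~-sym (done g≈h) = done (sym g≈h)
  ~-sym (step a w) = ~-trans (~-sym w) (step (swap a) (done refl))

  ~-preorder : Preorder c ℓ (c ⊔ ℓ ⊔ p ⊔ q)
  ~-preorder = record
    { Carrier    = Carrier
    ; _≈_        = _≈_
    ; _≲_        = _~_
    ; isPreorder = record
      { isEquivalence = isEquivalence ; reflexive = done ; trans = ~-trans }
    }

  open import Relation.Binary.Reasoning.Preorder ~-preorder

  move : ∀ {l r g h} → L l → R r → (y : Carrier) → g ≈ l ∙ y → h ≈ y ∙ r → g ~ h
  move {l} {r} {g} {h} Ll Rr y g≈ly h≈yr = step (inj₁ (l , r , Ll , Rr , arc)) (done refl)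
    where
      arc : h ≈ (l ⁻¹ ∙ g) ∙ r
      arc = begin-equality
        h                    ≈⟨ h≈yr ⟩
        y ∙ r                ≈⟨ ∙-congʳ (\\-leftDividesʳ l y) ⟨
        (l ⁻¹ ∙ (l ∙ y)) ∙ r ≈⟨ ∙-congʳ (∙-congˡ g≈ly) ⟨
        (l ⁻¹ ∙ g) ∙ r       ∎

  move⁻¹ : ∀ {l r} → L l → R r → ∀ v → (l ∙ v) ∙ r ⁻¹ ~ v
  move⁻¹ {r = r} Ll Rr v = move Ll Rr (v ∙ r ⁻¹) (assoc _ _ _) (sym (//-rightDividesˡ r v))

  RightInvariant : Carrier → Set (c ⊔ ℓ ⊔ p ⊔ q)
  RightInvariant z = ∀ {g h} → g ~ h → g ∙ z ~ h ∙ z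

  rightInvariant : ∀ {z} → (∀ {l r} y → L l → R r → (l ∙ y) ∙ z ~ (y ∙ r) ∙ z) →
                   RightInvariant z
  rightInvariant {z} onMoves = translate
    where
      translateArc : ∀ {g h} → Arc L R g h → g ∙ z ~ h ∙ z
      translateArc {g} (l , r , Ll , Rr , h≈) =
        ~-respˡ (∙-congʳ (\\-leftDividesˡ l g))
          (~-respʳ (onMoves (l ⁻¹ ∙ g) Ll Rr) (∙-congʳ (sym h≈)))

      translate : RightInvariant z
      translate (done g≈h)       = done (∙-congʳ g≈h)
      translate (step (inj₁ a) w) = ~-trans (translateArc a) (translate w)
      translate (step (inj₂ a) w) = ~-trans (~-sym (translateArc a)) (translate w)

  rightInvariant-∙ : ∀ {z z′} → RightInvariant z → RightInvariant z′ →
                     RightInvariant (z ∙ z′)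
  rightInvariant-∙ inv inv′ w = ~-respˡ (assoc _ _ _) (~-respʳ (inv′ (inv w)) (assoc _ _ _))

  rightInvariant-^ : ∀ {z} → RightInvariant z → ∀ n → RightInvariant (z ^ n)
  rightInvariant-^ inv zero    w = ~-respˡ (sym (identityʳ _)) (~-respʳ w (sym (identityʳ _)))
  rightInvariant-^ inv (suc n) w = rightInvariant-∙ inv (rightInvariant-^ inv n) w

  collapse : ∀ {t} {S : Pred Carrier t} {z} →
             (∀ {s} p → S s → s ∙ p ~ p ∙ z) → RightInvariant z →
             ∀ {n x} → IsWord S n x → x ~ z ^ n
  collapse {S = S} {z} letter inv (k , ≡.refl , ws , all , x≈ws) =
    ~-respˡ (sym x≈ws) (collapseVec ws all)
    where
      prepend : ∀ {s w} n → S s → w ~ z ^ n → s ∙ w ~ z ^ suc n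
      prepend {s} {w} n Ss w~zⁿ = begin
        s ∙ w      ≲⟨ letter w Ss ⟩
        w ∙ z      ≲⟨ inv w~zⁿ ⟩
        z ^ n ∙ z  ≈⟨ ^-comm z n ⟩
        z ^ suc n  ∎

      collapseVec : ∀ {k} (ws : Vec Carrier (suc k)) → All S ws → prod ws ~ z ^ suc k
      collapseVec (s ∷ [])     (Ss ∷ _)   = ~-respˡ (identityʳ s) (prepend 0 Ss (done refl))
      collapseVec {suc k} (s ∷ v ∷ vs) (Ss ∷ all) = prepend (suc k) Ss (collapseVec (v ∷ vs) all)

  wordOfLength : ∀ {t} {S : Pred Carrier t} {s n} → S s → 0 < n → ∃[ x ] IsWord S n x
  wordOfLength {s = s} {n = suc k} Ss _ =
    prod ws , k , ≡.refl , ws , tabulate⁺ (λ _ → Ss) , refl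
    where
      ws : Vec Carrier (suc k)
      ws = tabulate (λ _ → s)

  wordLength-positive : ∀ {t} {S : Pred Carrier t} {n x} → IsWord S n x → 0 < n
  wordLength-positive (_ , ≡.refl , _) = z<s

  IdentityWord : ∀ {t} → Pred Carrier t → ℕ → Set (c ⊔ ℓ ⊔ p ⊔ q ⊔ t)
  IdentityWord S n = ∃[ x ] (IsWord S n x × x ~ ε)

  identityWord⇔ : ∀ {t} {S : Pred Carrier t} {s} (f : ℕ → Carrier) → S s →
                  (∀ {n x} → IsWord S n x → x ~ f n) →
                  ∀ n → IdentityWord S n ⇔ (0 < n × f n ~ ε)
  identityWord⇔ f Ss word~f n = mk⇔
    (λ (x , wx , x~ε) → wordLength-positive wx , ~-trans (~-sym (word~f wx)) x~ε)
    (λ (0<n , fn~ε) → let (x , wx) = wordOfLength Ss 0<n in x , wx , ~-trans (word~f wx) fn~ε)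

  module WithBasePoints {l₀ r₀ : Carrier} (Ll₀ : L l₀) (Rr₀ : R r₀) where

    swapL : ∀ {l l′} → L l → L l′ → ∀ v → l ∙ v ~ l′ ∙ v
    swapL Ll Ll′ v = ~-trans (move Ll Rr₀ v refl refl) (~-sym (move Ll′ Rr₀ v refl refl))

    swapR : ∀ {r r′} → R r → R r′ → ∀ v → v ∙ r ~ v ∙ r′
    swapR Rr Rr′ v = ~-trans (~-sym (move Ll₀ Rr v refl refl)) (move Ll₀ Rr′ v refl refl)

    r₀-invariant : RightInvariant r₀
    r₀-invariant = rightInvariant λ {l} {r} y Ll Rr → begin
      (l ∙ y) ∙ r₀    ≈⟨ assoc _ _ _ ⟩
      l ∙ (y ∙ r₀)    ≲⟨ swapL Ll Ll₀ (y ∙ r₀) ⟩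
      l₀ ∙ (y ∙ r₀)   ≈⟨ assoc _ _ _ ⟨
      (l₀ ∙ y) ∙ r₀   ≲⟨ swapR Rr₀ Rr (l₀ ∙ y) ⟩
      (l₀ ∙ y) ∙ r    ≈⟨ assoc _ _ _ ⟩
      l₀ ∙ (y ∙ r)    ≲⟨ move Ll₀ Rr₀ (y ∙ r) refl refl ⟩
      (y ∙ r) ∙ r₀    ∎

    r₀⁻¹-invariant : RightInvariant (r₀ ⁻¹)
    r₀⁻¹-invariant = rightInvariant λ {l} {r} y Ll Rr → begin
      (l ∙ y) ∙ r₀ ⁻¹                  ≲⟨ move⁻¹ Ll Rr₀ y ⟩
      y                                ≲⟨ move Ll₀ Rr (l₀ ⁻¹ ∙ y) (sym (\\-leftDividesˡ l₀ y)) refl ⟩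
      (l₀ ⁻¹ ∙ y) ∙ r                  ≈⟨ assoc _ _ _ ⟩
      l₀ ⁻¹ ∙ (y ∙ r)                  ≲⟨ ~-sym (move⁻¹ Ll₀ Rr₀ (l₀ ⁻¹ ∙ (y ∙ r))) ⟩
      (l₀ ∙ (l₀ ⁻¹ ∙ (y ∙ r))) ∙ r₀ ⁻¹ ≈⟨ ∙-congʳ (\\-leftDividesˡ l₀ (y ∙ r)) ⟩
      (y ∙ r) ∙ r₀ ⁻¹                  ∎

    word~power : ∀ {n x} → IsWord L n x → x ~ r₀ ^ n
    word~power = collapse (λ p Ll → move Ll Rr₀ p refl refl) r₀-invariant

    inverseWord~power : ∀ {n x} → IsWord (Inv L) n x → x ~ (r₀ ⁻¹) ^ n
    inverseWord~power = collapse letter r₀⁻¹-invariant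
      where
        letter : ∀ {s} p → Inv L s → s ∙ p ~ p ∙ r₀ ⁻¹
        letter {s} p (l , Ll , s≈l⁻¹) = begin
          s ∙ p                         ≈⟨ ∙-congʳ s≈l⁻¹ ⟩
          l ⁻¹ ∙ p                      ≲⟨ ~-sym (move⁻¹ Ll Rr₀ (l ⁻¹ ∙ p)) ⟩
          (l ∙ (l ⁻¹ ∙ p)) ∙ r₀ ⁻¹      ≈⟨ ∙-congʳ (\\-leftDividesˡ l p) ⟩
          p ∙ r₀ ⁻¹                     ∎

    identityWord⇔power : ∀ n → IdentityWord L n ⇔ (0 < n × r₀ ^ n ~ ε)
    identityWord⇔power = identityWord⇔ (r₀ ^_) Ll₀ word~power

    inverseIdentityWord⇔power : ∀ n → IdentityWord (Inv L) n ⇔ (0 < n × (r₀ ⁻¹) ^ n ~ ε)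
    inverseIdentityWord⇔power = identityWord⇔ ((r₀ ⁻¹) ^_) (l₀ , Ll₀ , refl) inverseWord~power

    cancelPower : ∀ {m n} → m < n → r₀ ^ m ~ r₀ ^ n → r₀ ^ (n ∸ m) ~ ε
    cancelPower {m} {n} m<n w = ~-sym (begin
      ε                                          ≈⟨ ^-inverseʳ r₀ m ⟨
      r₀ ^ m ∙ (r₀ ⁻¹) ^ m                       ≲⟨ rightInvariant-^ r₀⁻¹-invariant m w ⟩
      r₀ ^ n ∙ (r₀ ⁻¹) ^ m                       ≡⟨ ≡.cong (λ k → r₀ ^ k ∙ (r₀ ⁻¹) ^ m) (m∸n+n≡m (<⇒≤ m<n)) ⟨
      r₀ ^ (n ∸ m + m) ∙ (r₀ ⁻¹) ^ m             ≈⟨ ∙-congʳ (×-homo-+ r₀ (n ∸ m) m) ⟩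
      (r₀ ^ (n ∸ m) ∙ r₀ ^ m) ∙ (r₀ ⁻¹) ^ m      ≈⟨ assoc _ _ _ ⟩
      r₀ ^ (n ∸ m) ∙ (r₀ ^ m ∙ (r₀ ⁻¹) ^ m)      ≈⟨ ∙-congˡ (^-inverseʳ r₀ m) ⟩
      r₀ ^ (n ∸ m) ∙ ε                           ≈⟨ identityʳ _ ⟩
      r₀ ^ (n ∸ m)                               ∎)

    distinctPowers : ∀ {m n} → m ≢ n → r₀ ^ m ~ r₀ ^ n → ∃[ d ] (0 < d × r₀ ^ d ~ ε)
    distinctPowers {m} {n} m≢n w with <-cmp m n
    ... | tri< m<n _ _   = n ∸ m , m<n⇒0<n∸m m<n , cancelPower m<n w
    ... | tri≈ _ m≡n _   = contradiction m≡n m≢n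
    ... | tri> _ _ n<m   = m ∸ n , m<n⇒0<n∸m n<m , cancelPower n<m (~-sym w)

    doublePower : ∀ d → r₀ ^ d ~ ε → r₀ ^ (d + d) ~ r₀ ^ d
    doublePower d w = begin
      r₀ ^ (d + d)      ≈⟨ ×-homo-+ r₀ d d ⟩
      r₀ ^ d ∙ r₀ ^ d   ≲⟨ rightInvariant-^ r₀-invariant d w ⟩
      ε ∙ r₀ ^ d        ≈⟨ identityˡ _ ⟩
      r₀ ^ d            ∎

    -- r₀ ^ n ~ e iff (r₀⁻¹) ^ n ~ e: translate by the inverse power.
    invertPower : ∀ n → r₀ ^ n ~ ε → (r₀ ⁻¹) ^ n ~ ε
    invertPower n w = begin
      (r₀ ⁻¹) ^ n                 ≈⟨ identityˡ _ ⟨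
      ε ∙ (r₀ ⁻¹) ^ n             ≲⟨ ~-sym (rightInvariant-^ r₀⁻¹-invariant n w) ⟩
      r₀ ^ n ∙ (r₀ ⁻¹) ^ n        ≈⟨ ^-inverseʳ r₀ n ⟩
      ε                           ∎

    uninvertPower : ∀ n → (r₀ ⁻¹) ^ n ~ ε → r₀ ^ n ~ ε
    uninvertPower n w = begin
      r₀ ^ n                      ≈⟨ identityˡ _ ⟨
      ε ∙ r₀ ^ n                  ≲⟨ ~-sym (rightInvariant-^ r₀-invariant n w) ⟩
      (r₀ ⁻¹) ^ n ∙ r₀ ^ n        ≈⟨ ^-inverseˡ r₀ n ⟩
      ε                           ∎

    differentLengths⇔identityWord :
      (∃[ m ] ∃[ n ] ∃[ x ] ∃[ y ] (m ≢ n × IsWord L m x × IsWord L n y × x ~ y))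
      ⇔ (∃[ n ] IdentityWord L n)
    differentLengths⇔identityWord = mk⇔ toIdentity fromIdentity
      where
        toIdentity : (∃[ m ] ∃[ n ] ∃[ x ] ∃[ y ] (m ≢ n × IsWord L m x × IsWord L n y × x ~ y))
                     → ∃[ n ] IdentityWord L n
        toIdentity (m , n , x , y , m≢n , wx , wy , x~y) =
          let (d , 0<d , rᵈ~ε) = distinctPowers m≢n
                (~-trans (~-sym (word~power wx)) (~-trans x~y (word~power wy)))
          in d , Equivalence.from (identityWord⇔power d) (0<d , rᵈ~ε)

        fromIdentity : ∃[ n ] IdentityWord L n
                       → ∃[ m ] ∃[ n ] ∃[ x ] ∃[ y ] (m ≢ n × IsWord L m x × IsWord L n y × x ~ y)
        fromIdentity (n , iw) =
          let (0<n , rⁿ~ε) = Equivalence.to (identityWord⇔power n) iw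
              n<n+n        = m<m+n n 0<n
              (x , wx)     = wordOfLength Ll₀ 0<n
              (y , wy)     = wordOfLength Ll₀ (m<n⇒0<n n<n+n)
          in n , n + n , x , y , <⇒≢ n<n+n , wx , wy ,
             ~-trans (word~power wx) (~-trans (~-sym (doublePower n rⁿ~ε)) (~-sym (word~power wy)))

    identityWord⇔inverseIdentityWord : ∀ n → IdentityWord L n ⇔ IdentityWord (Inv L) n
    identityWord⇔inverseIdentityWord n = mk⇔
      (λ iw → let (0<n , w) = Equivalence.to (identityWord⇔power n) iw
              in Equivalence.from (inverseIdentityWord⇔power n) (0<n , invertPower n w))
      (λ iw → let (0<n , w) = Equivalence.to (inverseIdentityWord⇔power n) iw
              in Equivalence.from (identityWord⇔power n) (0<n , uninvertPower n w))

corollary3p3 : {c ℓ p q : Level} (G : Group c ℓ) (L : Pred (Group.Carrier G) p) (R : Pred (Group.Carrier G) q) →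
    TwoSided.Nonempty G L → TwoSided.Nonempty G R →
    ((∃[ m ] ∃[ n ] ∃[ x ] ∃[ y ] (m ≢ n × TwoSided.IsWord G L m x × TwoSided.IsWord G L n y × TwoSided.WeaklyConnected G L R x y))
      ⇔ (∃[ n ] ∃[ x ] (TwoSided.IsWord G L n x × TwoSided.WeaklyConnected G L R x (Group.ε G))))
    × ((n : ℕ) →
      (∃[ x ] (TwoSided.IsWord G L n x × TwoSided.WeaklyConnected G L R x (Group.ε G)))
      ⇔ (∃[ x ] (TwoSided.IsWord G (TwoSided.Inv G L) n x × TwoSided.WeaklyConnected G L R x (Group.ε G))))
corollary3p3 G L R (l₀ , Ll₀) (r₀ , Rr₀) =
  differentLengths⇔identityWord , identityWord⇔inverseIdentityWord
  where open WeakComponents.WithBasePoints G L R Ll₀ Rr₀
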